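{- Let $p$ be a prime, $k\ge 2$, and let $\varphi\in\mathbb{Z}[x]$ be monic and irreducible modulo $p$. Let $f\in\mathbb{Z}[x]$ with $f\equiv\varphi^e\bmod p$, and let $a$ be a nonnegative integer with $a\le e/2$. Define $$E(y):=f(x)\left(\varphi^{a(k-1)}+\varphi^{a(k-2)}(py)+\cdots+\varphi^{a}(py)^{k-2}+(py)^{k-1}\right)\in\mathbb{Z}[x][y].$$ If $y\in\mathbb{Z}[x]$ satisfies $E(y)\equiv 0\bmod\langle p^k,\varphi^{ak}\rangle$, then $E(y+p^{k-2}z)\equiv 0\bmod\langle p^k,\varphi^{ak}\rangle$ for every $z\in\mathbb{Z}[x]$.
   Context: $\langle p^k,\varphi^{ak}\rangle$ is the ideal of $\mathbb{Z}[x]$ generated by $p^k$ and $\varphi^{ak}$. Equivalently: writing a root as $y=y_0+py_1+\dots+p^{k-1}y_{k-1}$, only $y_0,\dots,y_{k-3}$ matter. -}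

module Defs where

open import Data.Nat as ℕ using (ℕ; zero; suc; _∸_)
open import Data.Integer as ℤ using (ℤ; +_; 0ℤ; 1ℤ)
open import Data.List using (List; []; _∷_; _++_; map; foldr; upTo)
open import Data.List.Relation.Unary.All using (All)
open import Data.Product using (Σ; ∃; _×_)
open import Data.Sum using (_⊎_)
open import Relation.Nullary using (¬_)
open import Relation.Binary.PropositionalEquality using (_≡_)

-- Polynomials in ℤ[x] as coefficient lists, lowest degree first.
-- Two lists represent the same polynomial iff their difference has all
-- coefficients zero (trailing zeros are irrelevant).
Poly : Set
Poly = List ℤ

infixl 6 _+ₚ_ _-ₚ_
infixl 7 _*ₚ_
infixr 8 _^ₚ_

_+ₚ_ : Poly → Poly → Poly
[]      +ₚ q       = q
(a ∷ p) +ₚ []      = a ∷ p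
(a ∷ p) +ₚ (b ∷ q) = (a ℤ.+ b) ∷ (p +ₚ q)

-ₚ_ : Poly → Poly
-ₚ p = map ℤ.-_ p

_-ₚ_ : Poly → Poly → Poly
p -ₚ q = p +ₚ (-ₚ q)

_·ₚ_ : ℤ → Poly → Poly
c ·ₚ p = map (c ℤ.*_) p

_*ₚ_ : Poly → Poly → Poly
[]      *ₚ q = []
(a ∷ p) *ₚ q = (a ·ₚ q) +ₚ (0ℤ ∷ (p *ₚ q))

const : ℤ → Poly
const c = c ∷ []

oneₚ : Poly
oneₚ = const 1ℤ

_^ₚ_ : Poly → ℕ → Poly
p ^ₚ zero  = oneₚ
p ^ₚ suc n = p *ₚ (p ^ₚ n)

sumₚ : List Poly → Poly
sumₚ = foldr _+ₚ_ []

IsZero : Poly → Set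
IsZero p = All (_≡ 0ℤ) p

_≈ₚ_ : Poly → Poly → Set
p ≈ₚ q = IsZero (p -ₚ q)

Monic : Poly → Set
Monic φ = Σ Poly λ q → φ ≈ₚ (q ++ (1ℤ ∷ []))

_≡_[modℤ_] : Poly → Poly → ℕ → Set
g ≡ h [modℤ m ] = Σ Poly λ w → (g -ₚ h) ≈ₚ ((+ m) ·ₚ w)

UnitMod : ℕ → Poly → Set
UnitMod p g = Σ Poly λ u → (g *ₚ u) ≡ oneₚ [modℤ p ]

IrreducibleMod : ℕ → Poly → Set
IrreducibleMod p φ =
  ¬ (φ ≡ [] [modℤ p ]) × ¬ UnitMod p φ ×
  (∀ g h → φ ≡ (g *ₚ h) [modℤ p ] → UnitMod p g ⊎ UnitMod p h)

InIdeal : ℕ → Poly → Poly → Set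
InIdeal m ψ g = Σ Poly λ u → Σ Poly λ v → g ≈ₚ (((+ m) ·ₚ u) +ₚ (ψ *ₚ v))

E : ℕ → ℕ → ℕ → Poly → Poly → Poly → Poly
E p k a f φ y =
  f *ₚ sumₚ (map (λ i → (φ ^ₚ (a ℕ.* (k ∸ 1 ∸ i))) *ₚ (((+ p) ·ₚ y) ^ₚ i))
                 (upTo k))

module Submission where

-- Put k = k' + 2, P = p, Q = p^k, Ψ = φ^{ak} and y' = y + p^{k'} z.  Term by term, (py')^i - (py)^i
-- = p^i ((y + p^{k'} z)^i - y^i) is a multiple of p^{i+k'}; so the i-th
-- correction term of E(y') - E(y) is
--   * zero for i = 0,
--   * f φ^{a k'} p^{k-1} s for i = 1, which lies in ⟨Q, Ψ⟩ because
--     f ≡ φ^e (mod p) and e + a k' ≥ a k (this is where 2a ≤ e is used),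
--   * a multiple of p^{i+k'}, hence of p^k, for i ≥ 2.
-- Hence E(y') ≡ E(y) modulo ⟨Q, Ψ⟩, and E(y) ∈ ⟨Q, Ψ⟩ gives E(y') ∈ ⟨Q, Ψ⟩.

open import Defs
open import Algebra.Bundles using (CommutativeRing)
open import Data.Integer as ℤ using (ℤ; +_; 0ℤ; 1ℤ)
import Data.Integer.Properties as ℤ
open import Data.Integer.Tactic.RingSolver using (solve-∀)
open import Data.List using (List; []; _∷_; map; foldr; upTo)
open import Data.List.Relation.Unary.All using ([]; _∷_)
open import Data.Nat as ℕ using (ℕ; zero; suc; _≤_; s≤s)
import Data.Nat.Properties as ℕ
import Data.Nat.Tactic.RingSolver as ℕ-Solver
open import Data.Nat.Primality using (Prime)
open import Data.Product using (Σ; _,_; _×_; proj₁; proj₂)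
open import Level using (0ℓ; _⊔_) renaming (suc to lsuc)
open import Relation.Binary.PropositionalEquality
  using (_≡_; refl; sym; trans; cong; cong₂; module ≡-Reasoning)

exponent-split : ∀ e a k' → 2 ℕ.* a ≤ e →
                 e ℕ.+ a ℕ.* k' ≡ a ℕ.* suc (suc k') ℕ.+ (e ℕ.∸ 2 ℕ.* a)
exponent-split e a k' 2a≤e = begin
  e ℕ.+ a ℕ.* k'                                ≡⟨ cong (ℕ._+ a ℕ.* k') (sym (ℕ.m+[n∸m]≡n 2a≤e)) ⟩
  (2 ℕ.* a ℕ.+ (e ℕ.∸ 2 ℕ.* a)) ℕ.+ a ℕ.* k'    ≡⟨ regroup a (e ℕ.∸ 2 ℕ.* a) k' ⟩
  a ℕ.* (2 ℕ.+ k') ℕ.+ (e ℕ.∸ 2 ℕ.* a)          ∎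
  where
  open ≡-Reasoning
  regroup : ∀ a r k' → (2 ℕ.* a ℕ.+ r) ℕ.+ a ℕ.* k' ≡ a ℕ.* (2 ℕ.+ k') ℕ.+ r
  regroup = ℕ-Solver.solve-∀

-- Ideals, congruences modulo ideals and the lifting argument, in an
-- arbitrary commutative ring R.
module RingArgument {c ℓ} (R : CommutativeRing c ℓ) where
  open CommutativeRing R renaming (refl to ≈-refl; sym to ≈-sym; trans to ≈-trans)
  open import Algebra.Properties.Semiring.Exp semiring using (_^_; ^-congˡ; ^-congʳ; ^-homo-*)
  open import Algebra.Properties.CommutativeSemiring.Exp commutativeSemiring using (^-distrib-*)
  open import Algebra.Solver.Ring.NaturalCoefficients.Default commutativeSemiring
  open import Relation.Binary.Reasoning.Setoid setoid

  Subset : Set (lsuc (c ⊔ ℓ))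
  Subset = Carrier → Set (c ⊔ ℓ)

  record IsIdeal (J : Subset) : Set (c ⊔ ℓ) where
    field
      ∈-resp-≈ : ∀ {g h} → g ≈ h → J g → J h
      0∈       : J 0#
      +-closed : ∀ {g h} → J g → J h → J (g + h)
      *-closed : ∀ s {g} → J g → J (s * g)

  ⟨_,_⟩ : Carrier → Carrier → Subset
  ⟨ Q , Ψ ⟩ g = Σ Carrier λ u → Σ Carrier λ v → g ≈ Q * u + Ψ * v

  ⟨,⟩-isIdeal : ∀ Q Ψ → IsIdeal ⟨ Q , Ψ ⟩
  ⟨,⟩-isIdeal Q Ψ = record
    { ∈-resp-≈ = λ { g≈h (u , v , g≈) → u , v , ≈-trans (≈-sym g≈h) g≈ }
    ; 0∈       = 0# , 0# , zero-combination Q Ψ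
    ; +-closed = λ { (u , v , g≈) (u' , v' , h≈) →
        u + u' , v + v' , ≈-trans (+-cong g≈ h≈) (add-combinations Q Ψ u v u' v') }
    ; *-closed = λ { s (u , v , g≈) →
        s * u , s * v , ≈-trans (*-congˡ g≈) (scale-combination Q Ψ u v s) }
    }
    where
    zero-combination : ∀ Q Ψ → 0# ≈ Q * 0# + Ψ * 0#
    zero-combination = solve 2 (λ Q Ψ → con 0 := Q :* con 0 :+ Ψ :* con 0) ≈-refl
    add-combinations : ∀ Q Ψ u v u' v' →
      (Q * u + Ψ * v) + (Q * u' + Ψ * v') ≈ Q * (u + u') + Ψ * (v + v')
    add-combinations = solve 6 (λ Q Ψ u v u' v' →
      (Q :* u :+ Ψ :* v) :+ (Q :* u' :+ Ψ :* v') := Q :* (u :+ u') :+ Ψ :* (v :+ v')) ≈-refl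
    scale-combination : ∀ Q Ψ u v s → s * (Q * u + Ψ * v) ≈ Q * (s * u) + Ψ * (s * v)
    scale-combination = solve 5 (λ Q Ψ u v s →
      s :* (Q :* u :+ Ψ :* v) := Q :* (s :* u) :+ Ψ :* (s :* v)) ≈-refl

  generator₁ : ∀ Q Ψ u → ⟨ Q , Ψ ⟩ (Q * u)
  generator₁ Q Ψ u = u , 0# , solve 3 (λ Q Ψ u → Q :* u := Q :* u :+ Ψ :* con 0) ≈-refl Q Ψ u

  _∶_ : Subset → Carrier → Subset
  (J ∶ f) g = J (f * g)

  ∶-isIdeal : ∀ {J} → IsIdeal J → ∀ f → IsIdeal (J ∶ f)
  ∶-isIdeal J-ideal f = record
    { ∈-resp-≈ = λ g≈h → ∈-resp-≈ (*-congˡ g≈h)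
    ; 0∈       = ∈-resp-≈ (≈-sym (zeroʳ f)) 0∈
    ; +-closed = λ fg∈ fh∈ → ∈-resp-≈ (≈-sym (distribˡ f _ _)) (+-closed fg∈ fh∈)
    ; *-closed = λ s {g} fg∈ → ∈-resp-≈ (left-commute s f g) (*-closed s fg∈)
    }
    where
    open IsIdeal J-ideal
    left-commute : ∀ s f g → s * (f * g) ≈ f * (s * g)
    left-commute = solve 3 (λ s f g → s :* (f :* g) := f :* (s :* g)) ≈-refl

  infix 4 _≡_mod_
  _≡_mod_ : Carrier → Carrier → Subset → Set (c ⊔ ℓ)
  g ≡ h mod J = Σ Carrier λ d → g ≈ h + d × J d

  sum-cong : ∀ {J} → IsIdeal J → ∀ {t t' : ℕ → Carrier} (L : List ℕ) →
             (∀ i → t' i ≡ t i mod J) →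
             foldr _+_ 0# (map t' L) ≡ foldr _+_ 0# (map t L) mod J
  sum-cong J-ideal []      _     = 0# , ≈-sym (+-identityʳ 0#) , IsIdeal.0∈ J-ideal
  sum-cong J-ideal (i ∷ L) t'≡t with t'≡t i | sum-cong J-ideal L t'≡t
  ... | d , t'i≈ , d∈ | D , Σ'≈ , D∈ =
    d + D , ≈-trans (+-cong t'i≈ Σ'≈) (interchange _ _ _ _) , IsIdeal.+-closed J-ideal d∈ D∈
    where
    interchange : ∀ a b c d → (a + b) + (c + d) ≈ (a + c) + (b + d)
    interchange = solve 4 (λ a b c d → (a :+ b) :+ (c :+ d) := (a :+ c) :+ (b :+ d)) ≈-refl

  *-mod∶ : ∀ {J} f {g h} → g ≡ h mod (J ∶ f) → f * g ≡ f * h mod J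
  *-mod∶ f (d , g≈ , fd∈) = f * d , ≈-trans (*-congˡ g≈) (distribˡ f _ d) , fd∈

  ≡mod-∈ : ∀ {J} → IsIdeal J → ∀ {g h} → g ≡ h mod J → J h → J g
  ≡mod-∈ J-ideal (d , g≈ , d∈) h∈ = ∈-resp-≈ (≈-sym g≈) (+-closed h∈ d∈)
    where open IsIdeal J-ideal

  pow-shift : ∀ x d n → Σ Carrier λ S → (x + d) ^ n ≈ x ^ n + d * S
  pow-shift x d zero    = 0# , solve 2 (λ X d → X := X :+ d :* con 0) ≈-refl 1# d
  pow-shift x d (suc n) with pow-shift x d n
  ... | S , xdⁿ≈ = x ^ n + (x + d) * S ,
    ≈-trans (*-congˡ xdⁿ≈) (expand x d (x ^ n) S)
    where
    expand : ∀ x d X S → (x + d) * (X + d * S) ≈ x * X + d * (X + (x + d) * S)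
    expand = solve 4 (λ x d X S →
      (x :+ d) :* (X :+ d :* S) := x :* X :+ d :* (X :+ (x :+ d) :* S)) ≈-refl

  Σ-cong : ∀ {t t' : ℕ → Carrier} (L : List ℕ) → (∀ i → t i ≈ t' i) →
           foldr _+_ 0# (map t L) ≈ foldr _+_ 0# (map t' L)
  Σ-cong []      _    = ≈-refl
  Σ-cong (i ∷ L) t≈t' = +-cong (t≈t' i) (Σ-cong L t≈t')

  Eᴿ : Carrier → ℕ → ℕ → Carrier → Carrier → Carrier → Carrier
  Eᴿ P k a f φ y = f * foldr _+_ 0# (map (λ i → φ ^ (a ℕ.* (k ℕ.∸ 1 ℕ.∸ i)) * (P * y) ^ i) (upTo k))

  module Lifting (P φ : Carrier) (k' a e : ℕ) (2a≤e : 2 ℕ.* a ≤ e)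
                 (f w : Carrier) (f≈ : f ≈ P * w + φ ^ e) where

    k : ℕ
    k = suc (suc k')

    I : Subset
    I = ⟨ P ^ k , φ ^ (a ℕ.* k) ⟩

    I-ideal : IsIdeal I
    I-ideal = ⟨,⟩-isIdeal (P ^ k) (φ ^ (a ℕ.* k))

    term : Carrier → ℕ → Carrier
    term y i = φ ^ (a ℕ.* (k ℕ.∸ 1 ℕ.∸ i)) * (P * y) ^ i

    high-correction : ∀ Φ j s → I (Φ * (P ^ suc (suc j) * (P ^ k' * s)))
    high-correction Φ j s = IsIdeal.∈-resp-≈ I-ideal (≈-sym factored)
      (generator₁ (P ^ k) (φ ^ (a ℕ.* k)) (P ^ j * (Φ * s)))
      where
      powers : P ^ suc (suc j) * P ^ k' ≈ P ^ k * P ^ j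
      powers = begin
        P ^ suc (suc j) * P ^ k'   ≈⟨ ^-homo-* P (suc (suc j)) k' ⟨
        P ^ (suc (suc j) ℕ.+ k')   ≈⟨ ^-congʳ P (cong (λ n → suc (suc n)) (ℕ.+-comm j k')) ⟩
        P ^ (k ℕ.+ j)              ≈⟨ ^-homo-* P k j ⟩
        P ^ k * P ^ j              ∎
      regroup : ∀ Φ A C s → Φ * (A * (C * s)) ≈ (A * C) * (Φ * s)
      regroup = solve 4 (λ Φ A C s → Φ :* (A :* (C :* s)) := (A :* C) :* (Φ :* s)) ≈-refl
      factored : Φ * (P ^ suc (suc j) * (P ^ k' * s)) ≈ P ^ k * (P ^ j * (Φ * s))
      factored = begin
        Φ * (P ^ suc (suc j) * (P ^ k' * s))  ≈⟨ regroup Φ _ _ s ⟩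
        (P ^ suc (suc j) * P ^ k') * (Φ * s)  ≈⟨ *-congʳ powers ⟩
        (P ^ k * P ^ j) * (Φ * s)             ≈⟨ *-assoc _ _ _ ⟩
        P ^ k * (P ^ j * (Φ * s))             ∎

    -- for i = 1 the correction φ^{ak'} p^{k-1} s needs the factor f:
    -- f = p w + φᵉ and φᵉ φ^{ak'} is a multiple of φ^{ak}
    linear-correction : ∀ s → (I ∶ f) (φ ^ (a ℕ.* k') * (P ^ 1 * (P ^ k' * s)))
    linear-correction s = w * (φ ^ (a ℕ.* k') * s) , φ ^ r * (P * (P ^ k' * s)) , (begin
      f * (φ ^ (a ℕ.* k') * ((P * 1#) * (P ^ k' * s)))
        ≈⟨ *-congʳ f≈ ⟩
      (P * w + φ ^ e) * (φ ^ (a ℕ.* k') * ((P * 1#) * (P ^ k' * s)))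
        ≈⟨ distribute P w (φ ^ e) (φ ^ (a ℕ.* k')) (P ^ k') s ⟩
      P ^ k * (w * (φ ^ (a ℕ.* k') * s)) + (φ ^ e * φ ^ (a ℕ.* k')) * (P * (P ^ k' * s))
        ≈⟨ +-congˡ (≈-trans (*-congʳ φ-powers) (*-assoc _ _ _)) ⟩
      P ^ k * (w * (φ ^ (a ℕ.* k') * s)) + φ ^ (a ℕ.* k) * (φ ^ r * (P * (P ^ k' * s))) ∎)
      where
      r : ℕ
      r = e ℕ.∸ 2 ℕ.* a
      φ-powers : φ ^ e * φ ^ (a ℕ.* k') ≈ φ ^ (a ℕ.* k) * φ ^ r
      φ-powers = begin
        φ ^ e * φ ^ (a ℕ.* k')      ≈⟨ ^-homo-* φ e (a ℕ.* k') ⟨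
        φ ^ (e ℕ.+ a ℕ.* k')        ≈⟨ ^-congʳ φ (exponent-split e a k' 2a≤e) ⟩
        φ ^ (a ℕ.* k ℕ.+ r)         ≈⟨ ^-homo-* φ (a ℕ.* k) r ⟩
        φ ^ (a ℕ.* k) * φ ^ r       ∎
      distribute : ∀ P w E Φ C s → (P * w + E) * (Φ * ((P * 1#) * (C * s)))
                   ≈ (P * (P * C)) * (w * (Φ * s)) + (E * Φ) * (P * (C * s))
      distribute = solve 6 (λ P w E Φ C s →
        (P :* w :+ E) :* (Φ :* ((P :* con 1) :* (C :* s)))
        := (P :* (P :* C)) :* (w :* (Φ :* s)) :+ (E :* Φ) :* (P :* (C :* s))) ≈-refl

    scaled-pow-shift : ∀ {y y'} z → y' ≈ y + P ^ k' * z → ∀ i →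
                       Σ Carrier λ S → (P * y') ^ i ≈ (P * y) ^ i + P ^ i * (P ^ k' * S)
    scaled-pow-shift {y} {y'} z y'≈ i with pow-shift y (P ^ k' * z) i
    ... | S , shifted = z * S , (begin
      (P * y') ^ i                                ≈⟨ ^-distrib-* P y' i ⟩
      P ^ i * y' ^ i                              ≈⟨ *-congˡ (^-congˡ i y'≈) ⟩
      P ^ i * (y + P ^ k' * z) ^ i                ≈⟨ *-congˡ shifted ⟩
      P ^ i * (y ^ i + P ^ k' * z * S)            ≈⟨ distribˡ (P ^ i) _ _ ⟩
      P ^ i * y ^ i + P ^ i * (P ^ k' * z * S)    ≈⟨ +-cong (^-distrib-* P y i) (*-congˡ (≈-sym (*-assoc _ _ _))) ⟨
      (P * y) ^ i + P ^ i * (P ^ k' * (z * S))    ∎)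

    term-shift : ∀ {y y'} z → y' ≈ y + P ^ k' * z → ∀ i → term y' i ≡ term y i mod (I ∶ f)
    term-shift z y'≈ zero    = 0# , ≈-sym (+-identityʳ _) , IsIdeal.0∈ (∶-isIdeal I-ideal f)
    term-shift z y'≈ (suc j) with scaled-pow-shift z y'≈ (suc j)
    ... | S , shifted = φ ^ (a ℕ.* (k ℕ.∸ 1 ℕ.∸ suc j)) * (P ^ suc j * (P ^ k' * S)) ,
        ≈-trans (*-congˡ shifted) (distribˡ _ _ _) , correction∈ j
      where
      correction∈ : ∀ j → (I ∶ f) (φ ^ (a ℕ.* (k ℕ.∸ 1 ℕ.∸ suc j)) * (P ^ suc j * (P ^ k' * S)))
      correction∈ zero    = linear-correction S
      correction∈ (suc j) = IsIdeal.*-closed I-ideal f (high-correction _ j S)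

    lift : ∀ {y y'} z → y' ≈ y + P ^ k' * z → I (Eᴿ P k a f φ y) → I (Eᴿ P k a f φ y')
    lift z y'≈ = ≡mod-∈ I-ideal
      (*-mod∶ f (sum-cong (∶-isIdeal I-ideal f) (upTo k) (term-shift z y'≈)))

-- ℤ[x], as coefficient lists up to coefficientwise equality, is a
-- commutative ring.
module CoefficientRing where
  coeff : Poly → ℕ → ℤ
  coeff []      n       = 0ℤ
  coeff (c ∷ g) zero    = c
  coeff (c ∷ g) (suc n) = coeff g n

  infix 4 _~_
  record _~_ (g h : Poly) : Set where
    constructor mk~
    field at : ∀ n → coeff g n ≡ coeff h n
  open _~_ public

  ~-refl : ∀ {g} → g ~ g
  ~-refl = mk~ λ _ → refl

  ~-sym : ∀ {g h} → g ~ h → h ~ g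
  ~-sym g~h = mk~ λ n → sym (at g~h n)

  ~-trans : ∀ {g h r} → g ~ h → h ~ r → g ~ r
  ~-trans g~h h~r = mk~ λ n → trans (at g~h n) (at h~r n)

  ∷-cong : ∀ {a b g h} → a ≡ b → g ~ h → (a ∷ g) ~ (b ∷ h)
  ∷-cong a≡b g~h = mk~ λ { zero → a≡b ; (suc n) → at g~h n }

  ∷-injʳ : ∀ {a b g h} → (a ∷ g) ~ (b ∷ h) → g ~ h
  ∷-injʳ eq = mk~ λ n → at eq (suc n)

  coeff-+ : ∀ g h n → coeff (g +ₚ h) n ≡ coeff g n ℤ.+ coeff h n
  coeff-+ []      h       n       = sym (ℤ.+-identityˡ _)
  coeff-+ (a ∷ g) []      n       = sym (ℤ.+-identityʳ _)
  coeff-+ (a ∷ g) (b ∷ h) zero    = refl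
  coeff-+ (a ∷ g) (b ∷ h) (suc n) = coeff-+ g h n

  coeff-neg : ∀ g n → coeff (-ₚ g) n ≡ ℤ.- coeff g n
  coeff-neg []      n       = refl
  coeff-neg (a ∷ g) zero    = refl
  coeff-neg (a ∷ g) (suc n) = coeff-neg g n

  coeff-· : ∀ c g n → coeff (c ·ₚ g) n ≡ c ℤ.* coeff g n
  coeff-· c []      n       = sym (ℤ.*-zeroʳ c)
  coeff-· c (a ∷ g) zero    = refl
  coeff-· c (a ∷ g) (suc n) = coeff-· c g n

  coeff-shift : ∀ c g n → coeff (0ℤ ∷ (c ·ₚ g)) n ≡ c ℤ.* coeff (0ℤ ∷ g) n
  coeff-shift c g zero    = sym (ℤ.*-zeroʳ c)
  coeff-shift c g (suc n) = coeff-· c g n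

  coeff-*∷ : ∀ a g h n → coeff ((a ∷ g) *ₚ h) n ≡ a ℤ.* coeff h n ℤ.+ coeff (0ℤ ∷ (g *ₚ h)) n
  coeff-*∷ a g h n = trans (coeff-+ (a ·ₚ h) (0ℤ ∷ (g *ₚ h)) n) (cong (ℤ._+ _) (coeff-· a h n))

  +-cong : ∀ {g g' h h'} → g ~ g' → h ~ h' → (g +ₚ h) ~ (g' +ₚ h')
  +-cong {g} {g'} {h} {h'} g~g' h~h' = mk~ λ n →
    trans (coeff-+ g h n) (trans (cong₂ ℤ._+_ (at g~g' n) (at h~h' n)) (sym (coeff-+ g' h' n)))

  neg-cong : ∀ {g h} → g ~ h → (-ₚ g) ~ (-ₚ h)
  neg-cong {g} {h} g~h = mk~ λ n →
    trans (coeff-neg g n) (trans (cong ℤ.-_ (at g~h n)) (sym (coeff-neg h n)))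

  +-assoc : ∀ g h r → ((g +ₚ h) +ₚ r) ~ (g +ₚ (h +ₚ r))
  +-assoc g h r = mk~ λ n → begin
    coeff ((g +ₚ h) +ₚ r) n                 ≡⟨ coeff-+ (g +ₚ h) r n ⟩
    coeff (g +ₚ h) n ℤ.+ coeff r n          ≡⟨ cong (ℤ._+ coeff r n) (coeff-+ g h n) ⟩
    coeff g n ℤ.+ coeff h n ℤ.+ coeff r n   ≡⟨ ℤ.+-assoc (coeff g n) (coeff h n) (coeff r n) ⟩
    coeff g n ℤ.+ (coeff h n ℤ.+ coeff r n) ≡⟨ cong (ℤ._+_ (coeff g n)) (sym (coeff-+ h r n)) ⟩
    coeff g n ℤ.+ coeff (h +ₚ r) n          ≡⟨ sym (coeff-+ g (h +ₚ r) n) ⟩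
    coeff (g +ₚ (h +ₚ r)) n                 ∎
    where open ≡-Reasoning

  +-comm : ∀ g h → (g +ₚ h) ~ (h +ₚ g)
  +-comm g h = mk~ λ n →
    trans (coeff-+ g h n) (trans (ℤ.+-comm (coeff g n) (coeff h n)) (sym (coeff-+ h g n)))

  +-identityʳ : ∀ g → (g +ₚ []) ~ g
  +-identityʳ g = mk~ λ n → trans (coeff-+ g [] n) (ℤ.+-identityʳ _)

  +-inverseˡ : ∀ g → ((-ₚ g) +ₚ g) ~ []
  +-inverseˡ g = mk~ λ n →
    trans (coeff-+ (-ₚ g) g n) (trans (cong (ℤ._+ coeff g n) (coeff-neg g n)) (ℤ.+-inverseˡ (coeff g n)))

  +-interchange : ∀ a b c d → ((a +ₚ b) +ₚ (c +ₚ d)) ~ ((a +ₚ c) +ₚ (b +ₚ d))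
  +-interchange a b c d = mk~ λ n → begin
    coeff ((a +ₚ b) +ₚ (c +ₚ d)) n                            ≡⟨ coeff-+ (a +ₚ b) (c +ₚ d) n ⟩
    coeff (a +ₚ b) n ℤ.+ coeff (c +ₚ d) n                     ≡⟨ cong₂ ℤ._+_ (coeff-+ a b n) (coeff-+ c d n) ⟩
    (coeff a n ℤ.+ coeff b n) ℤ.+ (coeff c n ℤ.+ coeff d n)   ≡⟨ swap (coeff a n) (coeff b n) (coeff c n) (coeff d n) ⟩
    (coeff a n ℤ.+ coeff c n) ℤ.+ (coeff b n ℤ.+ coeff d n)   ≡⟨ sym (cong₂ ℤ._+_ (coeff-+ a c n) (coeff-+ b d n)) ⟩
    coeff (a +ₚ c) n ℤ.+ coeff (b +ₚ d) n                     ≡⟨ sym (coeff-+ (a +ₚ c) (b +ₚ d) n) ⟩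
    coeff ((a +ₚ c) +ₚ (b +ₚ d)) n                            ∎
    where
    open ≡-Reasoning
    swap : ∀ w x y z → (w ℤ.+ x) ℤ.+ (y ℤ.+ z) ≡ (w ℤ.+ y) ℤ.+ (x ℤ.+ z)
    swap = solve-∀

  ·-distrib-+ : ∀ c g h → (c ·ₚ (g +ₚ h)) ~ ((c ·ₚ g) +ₚ (c ·ₚ h))
  ·-distrib-+ c g h = mk~ λ n → begin
    coeff (c ·ₚ (g +ₚ h)) n                ≡⟨ coeff-· c (g +ₚ h) n ⟩
    c ℤ.* coeff (g +ₚ h) n                 ≡⟨ cong (c ℤ.*_) (coeff-+ g h n) ⟩
    c ℤ.* (coeff g n ℤ.+ coeff h n)        ≡⟨ ℤ.*-distribˡ-+ c (coeff g n) (coeff h n) ⟩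
    c ℤ.* coeff g n ℤ.+ c ℤ.* coeff h n    ≡⟨ sym (cong₂ ℤ._+_ (coeff-· c g n) (coeff-· c h n)) ⟩
    coeff (c ·ₚ g) n ℤ.+ coeff (c ·ₚ h) n  ≡⟨ sym (coeff-+ (c ·ₚ g) (c ·ₚ h) n) ⟩
    coeff ((c ·ₚ g) +ₚ (c ·ₚ h)) n         ∎
    where open ≡-Reasoning

  *-zeroˡ : ∀ g h → [] ~ g → [] ~ (g *ₚ h)
  *-zeroˡ []      h _    = ~-refl
  *-zeroˡ (a ∷ g) h 0~ag = mk~ λ n → begin
    0ℤ                                          ≡⟨ at (zero-shift (*-zeroˡ g h (mk~ λ m → at 0~ag (suc m)))) n ⟩
    coeff (0ℤ ∷ (g *ₚ h)) n                     ≡⟨ sym (ℤ.+-identityˡ _) ⟩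
    0ℤ ℤ.+ coeff (0ℤ ∷ (g *ₚ h)) n              ≡⟨ cong (ℤ._+ coeff (0ℤ ∷ (g *ₚ h)) n) (sym (ℤ.*-zeroˡ (coeff h n))) ⟩
    0ℤ ℤ.* coeff h n ℤ.+ coeff (0ℤ ∷ (g *ₚ h)) n ≡⟨ cong (λ c → c ℤ.* coeff h n ℤ.+ _) (at 0~ag 0) ⟩
    a ℤ.* coeff h n ℤ.+ coeff (0ℤ ∷ (g *ₚ h)) n  ≡⟨ sym (coeff-*∷ a g h n) ⟩
    coeff ((a ∷ g) *ₚ h) n                      ∎
    where
    open ≡-Reasoning
    zero-shift : ∀ {r} → [] ~ r → [] ~ (0ℤ ∷ r)
    zero-shift 0~r = mk~ λ { zero → refl ; (suc m) → at 0~r m }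

  *-congˡ : ∀ {g g'} h → g ~ g' → (g *ₚ h) ~ (g' *ₚ h)
  *-congˡ {[]}    {g'}     h g~g' = *-zeroˡ g' h g~g'
  *-congˡ {a ∷ g} {[]}     h g~g' = ~-sym (*-zeroˡ (a ∷ g) h (~-sym g~g'))
  *-congˡ {a ∷ g} {b ∷ g'} h g~g' = mk~ λ n → trans (coeff-*∷ a g h n)
    (trans (cong₂ (λ c r → c ℤ.* coeff h n ℤ.+ r) (at g~g' 0)
                  (at (∷-cong {0ℤ} refl (*-congˡ h (∷-injʳ g~g'))) n))
           (sym (coeff-*∷ b g' h n)))

  *-zeroʳ : ∀ g → (g *ₚ []) ~ []
  *-zeroʳ []      = ~-refl
  *-zeroʳ (a ∷ g) = mk~ λ { zero → refl ; (suc n) → at (*-zeroʳ g) n }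

  *-∷ʳ : ∀ g a h → (g *ₚ (a ∷ h)) ~ ((a ·ₚ g) +ₚ (0ℤ ∷ (g *ₚ h)))
  *-∷ʳ []      a h = mk~ λ { zero → refl ; (suc n) → refl }
  *-∷ʳ (b ∷ g) a h = ∷-cong
    (trans (ℤ.+-identityʳ _) (trans (ℤ.*-comm b a) (sym (ℤ.+-identityʳ _))))
    (~-trans (+-cong (~-refl {b ·ₚ h}) (*-∷ʳ g a h))
    (~-trans (~-sym (+-assoc (b ·ₚ h) (a ·ₚ g) (0ℤ ∷ (g *ₚ h))))
    (~-trans (+-cong (+-comm (b ·ₚ h) (a ·ₚ g)) ~-refl)
             (+-assoc (a ·ₚ g) (b ·ₚ h) (0ℤ ∷ (g *ₚ h))))))

  *-comm : ∀ g h → (g *ₚ h) ~ (h *ₚ g)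
  *-comm []      h = ~-sym (*-zeroʳ h)
  *-comm (a ∷ g) h =
    ~-trans (+-cong (~-refl {a ·ₚ h}) (∷-cong refl (*-comm g h))) (~-sym (*-∷ʳ h a g))

  *-congʳ : ∀ g {h h'} → h ~ h' → (g *ₚ h) ~ (g *ₚ h')
  *-congʳ g {h} {h'} h~h' = ~-trans (*-comm g h) (~-trans (*-congˡ g h~h') (*-comm h' g))

  *-distribˡ-+ : ∀ r g h → (r *ₚ (g +ₚ h)) ~ ((r *ₚ g) +ₚ (r *ₚ h))
  *-distribˡ-+ []      g h = ~-refl
  *-distribˡ-+ (a ∷ r) g h =
    ~-trans (+-cong (·-distrib-+ a g h) (∷-cong refl (*-distribˡ-+ r g h)))
            (+-interchange (a ·ₚ g) (a ·ₚ h) (0ℤ ∷ (r *ₚ g)) (0ℤ ∷ (r *ₚ h)))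

  *-distribʳ-+ : ∀ r g h → ((g +ₚ h) *ₚ r) ~ ((g *ₚ r) +ₚ (h *ₚ r))
  *-distribʳ-+ r g h = ~-trans (*-comm (g +ₚ h) r)
    (~-trans (*-distribˡ-+ r g h) (+-cong (*-comm r g) (*-comm r h)))

  ·-*-assoc : ∀ c g h → ((c ·ₚ g) *ₚ h) ~ (c ·ₚ (g *ₚ h))
  ·-*-assoc c []      h = ~-refl
  ·-*-assoc c (b ∷ g) h = mk~ λ n → begin
    coeff ((c ℤ.* b ∷ (c ·ₚ g)) *ₚ h) n                                 ≡⟨ coeff-*∷ (c ℤ.* b) (c ·ₚ g) h n ⟩
    c ℤ.* b ℤ.* coeff h n ℤ.+ coeff (0ℤ ∷ ((c ·ₚ g) *ₚ h)) n            ≡⟨ cong (ℤ._+_ (c ℤ.* b ℤ.* coeff h n)) (at (∷-cong {0ℤ} refl (·-*-assoc c g h)) n) ⟩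
    c ℤ.* b ℤ.* coeff h n ℤ.+ coeff (0ℤ ∷ (c ·ₚ (g *ₚ h))) n            ≡⟨ cong (ℤ._+_ (c ℤ.* b ℤ.* coeff h n)) (coeff-shift c (g *ₚ h) n) ⟩
    c ℤ.* b ℤ.* coeff h n ℤ.+ c ℤ.* coeff (0ℤ ∷ (g *ₚ h)) n             ≡⟨ factor c b (coeff h n) (coeff (0ℤ ∷ (g *ₚ h)) n) ⟩
    c ℤ.* (b ℤ.* coeff h n ℤ.+ coeff (0ℤ ∷ (g *ₚ h)) n)                 ≡⟨ cong (c ℤ.*_) (sym (coeff-*∷ b g h n)) ⟩
    c ℤ.* coeff ((b ∷ g) *ₚ h) n                                        ≡⟨ sym (coeff-· c ((b ∷ g) *ₚ h) n) ⟩
    coeff (c ·ₚ ((b ∷ g) *ₚ h)) n                                       ∎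
    where
    open ≡-Reasoning
    factor : ∀ c b x y → c ℤ.* b ℤ.* x ℤ.+ c ℤ.* y ≡ c ℤ.* (b ℤ.* x ℤ.+ y)
    factor = solve-∀

  shift-* : ∀ g h → ((0ℤ ∷ g) *ₚ h) ~ (0ℤ ∷ (g *ₚ h))
  shift-* g h = mk~ λ n → trans (coeff-*∷ 0ℤ g h n) (ℤ.+-identityˡ _)

  *-assoc : ∀ g h r → ((g *ₚ h) *ₚ r) ~ (g *ₚ (h *ₚ r))
  *-assoc []      h r = ~-refl
  *-assoc (a ∷ g) h r =
    ~-trans (*-distribʳ-+ r (a ·ₚ h) (0ℤ ∷ (g *ₚ h)))
    (+-cong (·-*-assoc a h r) (~-trans (shift-* (g *ₚ h) r) (∷-cong refl (*-assoc g h r))))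

  0∷[]~[] : (0ℤ ∷ []) ~ []
  0∷[]~[] = mk~ λ { zero → refl ; (suc n) → refl }

  *-identityˡ : ∀ g → (oneₚ *ₚ g) ~ g
  *-identityˡ g = mk~ λ n → begin
    coeff (oneₚ *ₚ g) n                        ≡⟨ coeff-*∷ 1ℤ [] g n ⟩
    1ℤ ℤ.* coeff g n ℤ.+ coeff (0ℤ ∷ []) n     ≡⟨ cong (ℤ._+_ (1ℤ ℤ.* coeff g n)) (at 0∷[]~[] n) ⟩
    1ℤ ℤ.* coeff g n ℤ.+ 0ℤ                    ≡⟨ ℤ.+-identityʳ _ ⟩
    1ℤ ℤ.* coeff g n                           ≡⟨ ℤ.*-identityˡ _ ⟩
    coeff g n                                  ∎
    where open ≡-Reasoning

  polyRing : CommutativeRing 0ℓ 0ℓ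
  polyRing = record
    { Carrier = Poly ; _≈_ = _~_ ; _+_ = _+ₚ_ ; _*_ = _*ₚ_ ; -_ = -ₚ_ ; 0# = [] ; 1# = oneₚ
    ; isCommutativeRing = record
      { isRing = record
        { +-isAbelianGroup = record
          { isGroup = record
            { isMonoid = record
              { isSemigroup = record
                { isMagma = record
                  { isEquivalence = record { refl = ~-refl ; sym = ~-sym ; trans = ~-trans }
                  ; ∙-cong = +-cong }
                ; assoc = +-assoc }
              ; identity = (λ _ → ~-refl) , +-identityʳ }
            ; inverse = +-inverseˡ , (λ g → ~-trans (+-comm g (-ₚ g)) (+-inverseˡ g))
            ; ⁻¹-cong = neg-cong }
          ; comm = +-comm }
        ; *-cong = λ {g} {g'} {h} h~ g~ → ~-trans (*-congˡ h h~) (*-congʳ g' g~)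
        ; *-assoc = *-assoc
        ; *-identity = *-identityˡ , (λ g → ~-trans (*-comm g oneₚ) (*-identityˡ g))
        ; distrib = *-distribˡ-+ , *-distribʳ-+ }
      ; *-comm = *-comm } }

open CoefficientRing
open RingArgument polyRing using (⟨_,_⟩; Σ-cong; Eᴿ; module Lifting)
open import Algebra.Properties.Semiring.Exp (CommutativeRing.semiring polyRing)
  using (^-congˡ) renaming (_^_ to _^ᴿ_)

difference-+ : ∀ g h → g ~ ((g -ₚ h) +ₚ h)
difference-+ g h = ~-sym (~-trans (+-assoc g (-ₚ h) h)
  (~-trans (+-cong (~-refl {g}) (+-inverseˡ h)) (+-identityʳ g)))

≈ₚ⇒~ : ∀ {g h} → g ≈ₚ h → g ~ h
≈ₚ⇒~ {g} {h} g-h≈0 = ~-trans (difference-+ g h) (+-cong (zero-list _ g-h≈0) ~-refl)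
  where
  zero-list : ∀ r → IsZero r → r ~ []
  zero-list []      []         = ~-refl
  zero-list (c ∷ r) (c≡0 ∷ r0) = mk~ λ { zero → c≡0 ; (suc n) → at (zero-list r r0) n }

~⇒≈ₚ : ∀ {g h} → g ~ h → g ≈ₚ h
~⇒≈ₚ {g} {h} g~h = zero-coeffs _ (~-trans (+-cong g~h ~-refl)
  (~-trans (+-comm h (-ₚ h)) (+-inverseˡ h)))
  where
  zero-coeffs : ∀ r → r ~ [] → IsZero r
  zero-coeffs []      _   = []
  zero-coeffs (c ∷ r) r~0 = at r~0 0 ∷ zero-coeffs r (mk~ λ n → at r~0 (suc n))

·ₚ~const* : ∀ c g → (c ·ₚ g) ~ (const c *ₚ g)
·ₚ~const* c g = ~-sym (~-trans (+-cong (~-refl {c ·ₚ g}) 0∷[]~[]) (+-identityʳ (c ·ₚ g)))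

const-^ : ∀ p n → const (+ (p ℕ.^ n)) ~ (const (+ p) ^ᴿ n)
const-^ p zero    = ~-refl
const-^ p (suc n) = ~-trans (mk~ λ { zero → const-* ; (suc m) → refl })
                            (*-congʳ (const (+ p)) (const-^ p n))
  where
  const-* : + (p ℕ.* p ℕ.^ n) ≡ + p ℤ.* + (p ℕ.^ n) ℤ.+ 0ℤ
  const-* = trans (ℤ.pos-* p (p ℕ.^ n)) (sym (ℤ.+-identityʳ _))

scalar-^ : ∀ p n u → ((+ (p ℕ.^ n)) ·ₚ u) ~ ((const (+ p) ^ᴿ n) *ₚ u)
scalar-^ p n u = ~-trans (·ₚ~const* (+ (p ℕ.^ n)) u) (*-congˡ u (const-^ p n))

^ₚ~^ᴿ : ∀ g n → (g ^ₚ n) ~ (g ^ᴿ n)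
^ₚ~^ᴿ g zero    = ~-refl
^ₚ~^ᴿ g (suc n) = *-congʳ g (^ₚ~^ᴿ g n)

modℤ⇒~ : ∀ f g p → f ≡ g [modℤ p ] → Σ Poly λ w → f ~ ((const (+ p) *ₚ w) +ₚ g)
modℤ⇒~ f g p (w , f-g≈pw) =
  w , ~-trans (difference-+ f g) (+-cong (~-trans (≈ₚ⇒~ f-g≈pw) (·ₚ~const* (+ p) w)) ~-refl)

E~Eᴿ : ∀ p k a f φ y → E p k a f φ y ~ Eᴿ (const (+ p)) k a f φ y
E~Eᴿ p k a f φ y = *-congʳ f (Σ-cong (upTo k) λ i →
  ~-trans (*-congˡ (((+ p) ·ₚ y) ^ₚ i) (^ₚ~^ᴿ φ (a ℕ.* (k ℕ.∸ 1 ℕ.∸ i))))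
          (*-congʳ (φ ^ᴿ (a ℕ.* (k ℕ.∸ 1 ℕ.∸ i)))
                   (~-trans (^ₚ~^ᴿ ((+ p) ·ₚ y) i) (^-congˡ i (·ₚ~const* (+ p) y)))))

fromInIdeal : ∀ p n {Ψ Ψ' g g'} → Ψ ~ Ψ' → g ~ g' →
              InIdeal (p ℕ.^ n) Ψ g → ⟨ const (+ p) ^ᴿ n , Ψ' ⟩ g'
fromInIdeal p n Ψ~Ψ' g~g' (u , v , g≈) = u , v ,
  ~-trans (~-sym g~g') (~-trans (≈ₚ⇒~ g≈)
    (+-cong (scalar-^ p n u) (*-congˡ v Ψ~Ψ')))

toInIdeal : ∀ p n {Ψ Ψ' g g'} → Ψ ~ Ψ' → g ~ g' →
            ⟨ const (+ p) ^ᴿ n , Ψ' ⟩ g → InIdeal (p ℕ.^ n) Ψ g'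
toInIdeal p n Ψ~Ψ' g~g' (u , v , g≈) = u , v , ~⇒≈ₚ
  (~-trans (~-sym g~g') (~-trans g≈
    (+-cong (~-sym (scalar-^ p n u)) (*-congˡ v (~-sym Ψ~Ψ')))))

open import Data.Nat using (_*_; _∸_; _^_)

lemma3 : (p k e a : ℕ) → Prime p → 2 ≤ k →
    (φ f : Poly) → Monic φ → IrreducibleMod p φ →
    f ≡ (φ ^ₚ e) [modℤ p ] → 2 * a ≤ e →
    (y : Poly) → InIdeal (p ^ k) (φ ^ₚ (a * k)) (E p k a f φ y) →
    (z : Poly) →
    InIdeal (p ^ k) (φ ^ₚ (a * k)) (E p k a f φ (y +ₚ ((+ (p ^ (k ∸ 2))) ·ₚ z)))
lemma3 p (suc (suc k')) e a _ (s≤s (s≤s _)) φ f _ _ f≡φᵉ 2a≤e y E[y]∈ z =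
  toInIdeal p k (^ₚ~^ᴿ φ (a * k)) (~-sym (E~Eᴿ p k a f φ y'))
    (lift z y'≈ (fromInIdeal p k (^ₚ~^ᴿ φ (a * k)) (E~Eᴿ p k a f φ y) E[y]∈))
  where
  k : ℕ
  k = suc (suc k')
  P : Poly
  P = const (+ p)
  y' : Poly
  y' = y +ₚ ((+ (p ^ k')) ·ₚ z)
  y'≈ : y' ~ (y +ₚ ((P ^ᴿ k') *ₚ z))
  y'≈ = +-cong (~-refl {y}) (scalar-^ p k' z)
  w : Poly
  w = proj₁ (modℤ⇒~ f (φ ^ₚ e) p f≡φᵉ)
  f≈ : f ~ ((P *ₚ w) +ₚ (φ ^ᴿ e))
  f≈ = ~-trans (proj₂ (modℤ⇒~ f (φ ^ₚ e) p f≡φᵉ)) (+-cong (~-refl {P *ₚ w}) (^ₚ~^ᴿ φ e))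
  open Lifting P φ k' a e 2a≤e f w f≈ using (lift)
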